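{- There exists a unique algebra homomorphism $\widetilde{\Delta}:U_q(\mathfrak{sl}_2)\to\mathfrak{W}_q$ sending $E\mapsto E_1+K_1^{ -1}E_2$, $F\mapsto F_1K_2+F_2$, $K^{\pm1}\mapsto K_1^{\pm1}K_2^{\pm1}$.
   Context: $q$ is a nonzero complex number which is not a root of unity; $[x,y]=xy-yx$, $[x,y]_q=qxy-q^{ -1}yx$; algebras are unital associative over $\mathbb C$. $U_q(\mathfrak{sl}_2)$ is generated by $E,F,K^{\pm1}$ with relations $KK^{ -1}=K^{ -1}K=1$, $[E,K]_q=[K,F]_q=0$, $[E,F]=\frac{K-K^{ -1}}{q-q^{ -1}}$. $\mathfrak{W}_q$ is generated by $E_1,E_2,F_1,F_2,K_1^{\pm1},K_2^{\pm1},I^{\pm1}$ with relations: $I$ central; $II^{ -1}=I^{ -1}I=1$, $K_iK_i^{ -1}=K_i^{ -1}K_i=1$ ($i=1,2$); $[K_1,E_2]=[K_1,F_2]=[K_1,K_2]=[K_2,E_1]=[K_2,F_1]=0$; $[E_1,K_1]_q=[K_1,F_1]_q=[E_2,K_2]_q=[K_2,F_2]_q=0$; $[E_1,E_2]=[E_1,F_2]=[F_1,E_2]=[F_1,F_2]=0$; $[E_1,F_1]=\frac{K_1-IK_1^{ -1}}{q-q^{ -1}}$; $[E_2,F_2]=\frac{IK_2-K_2^{ -1}}{q-q^{ -1}}$. -}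

module Defs where

open import Level using (Level; _⊔_)
open import Data.Nat using (ℕ; zero; suc)
open import Data.Product using (Σ; _×_)
open import Relation.Nullary using (¬_)
open import Algebra.Bundles using (CommutativeRing)

data GenU : Set where
  E F K Kinv : GenU

data GenW : Set where
  E₁ E₂ F₁ F₂ K₁ K₁inv K₂ K₂inv I Iinv : GenW

module _ {c ℓ} (R : CommutativeRing c ℓ) where
  open CommutativeRing R

  IsFieldCR : Set (c ⊔ ℓ)
  IsFieldCR = (¬ (1# ≈ 0#)) × (∀ x → ¬ (x ≈ 0#) → Σ Carrier (λ y → x * y ≈ 1#))

  pow : Carrier → ℕ → Carrier
  pow x zero    = 1#
  pow x (suc n) = x * pow x n

  NotRootOfUnity : Carrier → Set ℓ
  NotRootOfUnity q = ∀ n → ¬ (pow q (suc n) ≈ 1#)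

  -- Terms of the free (noncommutative) R-algebra on a set of generators

  infixl 6 _⊕_
  infixl 7 _⊗_

  data Tm (G : Set) : Set c where
    gen : G → Tm G
    sc  : Carrier → Tm G
    _⊕_ : Tm G → Tm G → Tm G
    _⊗_ : Tm G → Tm G → Tm G

  module _ {G : Set} where
    infixl 6 _⊖_
    _⊖_ : Tm G → Tm G → Tm G
    s ⊖ t = s ⊕ sc (- 1#) ⊗ t

    comm : Tm G → Tm G → Tm G
    comm x y = x ⊗ y ⊖ y ⊗ x

    -- [x,y]_q = q x y - q⁻¹ y x   (qi is the inverse of q)
    qcomm : Carrier → Carrier → Tm G → Tm G → Tm G
    qcomm q qi x y = sc q ⊗ x ⊗ y ⊖ sc qi ⊗ y ⊗ x

    -- Tm G modulo Cong Rl is the algebra presented by generators G and relations Rl.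
    data Cong (Rl : Tm G → Tm G → Set (c ⊔ ℓ)) : Tm G → Tm G → Set (c ⊔ ℓ) where
      rel    : ∀ {s t} → Rl s t → Cong Rl s t
      refl′  : ∀ {s} → Cong Rl s s
      sym′   : ∀ {s t} → Cong Rl s t → Cong Rl t s
      trans′ : ∀ {s t u} → Cong Rl s t → Cong Rl t u → Cong Rl s u
      c⊕-cong : ∀ {s s′ t t′} → Cong Rl s s′ → Cong Rl t t′ → Cong Rl (s ⊕ t) (s′ ⊕ t′)
      c⊗-cong : ∀ {s s′ t t′} → Cong Rl s s′ → Cong Rl t t′ → Cong Rl (s ⊗ t) (s′ ⊗ t′)
      c⊕-assoc : ∀ s t u → Cong Rl ((s ⊕ t) ⊕ u) (s ⊕ (t ⊕ u))
      c⊕-comm  : ∀ s t → Cong Rl (s ⊕ t) (t ⊕ s)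
      c⊕-zero  : ∀ s → Cong Rl (s ⊕ sc 0#) s
      c⊕-inv   : ∀ s → Cong Rl (s ⊕ sc (- 1#) ⊗ s) (sc 0#)
      c⊗-assoc : ∀ s t u → Cong Rl ((s ⊗ t) ⊗ u) (s ⊗ (t ⊗ u))
      c⊗-oneˡ  : ∀ s → Cong Rl (sc 1# ⊗ s) s
      c⊗-oneʳ  : ∀ s → Cong Rl (s ⊗ sc 1#) s
      cdistribˡ : ∀ s t u → Cong Rl (s ⊗ (t ⊕ u)) (s ⊗ t ⊕ s ⊗ u)
      cdistribʳ : ∀ s t u → Cong Rl ((t ⊕ u) ⊗ s) (t ⊗ s ⊕ u ⊗ s)
      csc-cong  : ∀ {a b} → a ≈ b → Cong Rl (sc a) (sc b)
      csc-+     : ∀ a b → Cong Rl (sc (a + b)) (sc a ⊕ sc b)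
      csc-*     : ∀ a b → Cong Rl (sc (a * b)) (sc a ⊗ sc b)
      csc-central : ∀ a s → Cong Rl (sc a ⊗ s) (s ⊗ sc a)

  -- Defining relations, with q, its inverse qi, and d = (q - q⁻¹)⁻¹

  module Rels (q qi d : Carrier) where

    g : GenU → Tm GenU
    g = gen

    data RelU : Tm GenU → Tm GenU → Set (c ⊔ ℓ) where
      KKinv : RelU (g K ⊗ g Kinv) (sc 1#)
      KinvK : RelU (g Kinv ⊗ g K) (sc 1#)
      EK    : RelU (qcomm q qi (g E) (g K)) (sc 0#)
      KF    : RelU (qcomm q qi (g K) (g F)) (sc 0#)
      EF    : RelU (comm (g E) (g F)) (sc d ⊗ (g K ⊖ g Kinv))

    w : GenW → Tm GenW
    w = gen

    data RelW : Tm GenW → Tm GenW → Set (c ⊔ ℓ) where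
      I-central : ∀ x → RelW (comm (w I) (w x)) (sc 0#)
      IIinv   : RelW (w I ⊗ w Iinv) (sc 1#)
      IinvI   : RelW (w Iinv ⊗ w I) (sc 1#)
      K₁K₁inv : RelW (w K₁ ⊗ w K₁inv) (sc 1#)
      K₁invK₁ : RelW (w K₁inv ⊗ w K₁) (sc 1#)
      K₂K₂inv : RelW (w K₂ ⊗ w K₂inv) (sc 1#)
      K₂invK₂ : RelW (w K₂inv ⊗ w K₂) (sc 1#)
      K₁E₂ : RelW (comm (w K₁) (w E₂)) (sc 0#)
      K₁F₂ : RelW (comm (w K₁) (w F₂)) (sc 0#)
      K₁K₂ : RelW (comm (w K₁) (w K₂)) (sc 0#)
      K₂E₁ : RelW (comm (w K₂) (w E₁)) (sc 0#)
      K₂F₁ : RelW (comm (w K₂) (w F₁)) (sc 0#)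
      E₁K₁ : RelW (qcomm q qi (w E₁) (w K₁)) (sc 0#)
      K₁F₁ : RelW (qcomm q qi (w K₁) (w F₁)) (sc 0#)
      E₂K₂ : RelW (qcomm q qi (w E₂) (w K₂)) (sc 0#)
      K₂F₂ : RelW (qcomm q qi (w K₂) (w F₂)) (sc 0#)
      E₁E₂ : RelW (comm (w E₁) (w E₂)) (sc 0#)
      E₁F₂ : RelW (comm (w E₁) (w F₂)) (sc 0#)
      F₁E₂ : RelW (comm (w F₁) (w E₂)) (sc 0#)
      F₁F₂ : RelW (comm (w F₁) (w F₂)) (sc 0#)
      E₁F₁ : RelW (comm (w E₁) (w F₁)) (sc d ⊗ (w K₁ ⊖ w I ⊗ w K₁inv))
      E₂F₂ : RelW (comm (w E₂) (w F₂)) (sc d ⊗ (w I ⊗ w K₂ ⊖ w K₂inv))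

    _≈U_ : Tm GenU → Tm GenU → Set (c ⊔ ℓ)
    _≈U_ = Cong RelU

    _≈W_ : Tm GenW → Tm GenW → Set (c ⊔ ℓ)
    _≈W_ = Cong RelW

    -- a map on representatives inducing a unital R-algebra homomorphism
    -- U_q(sl₂) → 𝔚_q
    record IsAlgHom (φ : Tm GenU → Tm GenW) : Set (c ⊔ ℓ) where
      field
        resp  : ∀ {s t} → s ≈U t → φ s ≈W φ t
        pres⊕ : ∀ s t → φ (s ⊕ t) ≈W (φ s ⊕ φ t)
        pres⊗ : ∀ s t → φ (s ⊗ t) ≈W (φ s ⊗ φ t)
        presSc : ∀ a → φ (sc a) ≈W sc a

    SendsGens : (Tm GenU → Tm GenW) → Set (c ⊔ ℓ)
    SendsGens φ =
        (φ (g E)    ≈W (w E₁ ⊕ w K₁inv ⊗ w E₂))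
      × (φ (g F)    ≈W (w F₁ ⊗ w K₂ ⊕ w F₂))
      × (φ (g K)    ≈W (w K₁ ⊗ w K₂))
      × (φ (g Kinv) ≈W (w K₁inv ⊗ w K₂inv))

{-# OPTIONS --safe #-}
-- Δ̃ is given on generators and extended structurally to terms, so it is a
-- homomorphism, and the only one with these values, as soon as it respects the
-- defining relations of U_q(sl₂). Write x ⇄⟨ a ⟩ y for x y = a·y x; this is
-- multiplicative and additive in either argument, and [x,y]_q = 0 means
-- x ⇄⟨ q⁻² ⟩ y. The K-relations then hold because the images are products of
-- pairwise q-commuting generators. In [Δ̃E, Δ̃F] the cross term [K₁⁻¹E₂, F₁K₂]
-- vanishes since the factors q² and q⁻² cancel, and the two diagonal terms
-- telescope to d(K₁K₂ - K₁⁻¹K₂⁻¹) because the contributions ∓ d I K₁⁻¹K₂ cancel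
-- (I is central).
module Submission where

open import Defs
open import Level using (_⊔_)
open import Data.Product using (Σ; _×_; _,_)
open import Algebra.Bundles using (CommutativeRing; Ring)
import Algebra.Properties.Ring as RingProperties
import Algebra.Properties.AbelianGroup as AbelianGroupProperties
import Algebra.Properties.CommutativeSemigroup as CommutativeSemigroupProperties
import Relation.Binary.Reasoning.Setoid as SetoidReasoning

module ScalarLemmas {c ℓ} (R : CommutativeRing c ℓ) where
  open CommutativeRing R
  open CommutativeSemigroupProperties *-commutativeSemigroup using (interchange)
  open SetoidReasoning setoid

  inverse-squares : ∀ {a b} → a * b ≈ 1# → (a * a) * (b * b) ≈ 1#
  inverse-squares {a} {b} ab≈1 = begin
    (a * a) * (b * b)  ≈⟨ interchange a a b b ⟩
    (a * b) * (a * b)  ≈⟨ *-cong ab≈1 ab≈1 ⟩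
    1# * 1#            ≈⟨ *-identityˡ 1# ⟩
    1#                 ∎

  inverse-times-square : ∀ {a b} → a * b ≈ 1# → a * (b * b) ≈ b
  inverse-times-square {a} {b} ab≈1 = begin
    a * (b * b)  ≈⟨ *-assoc a b b ⟨
    (a * b) * b  ≈⟨ *-congʳ ab≈1 ⟩
    1# * b       ≈⟨ *-identityˡ b ⟩
    b            ∎

module PresentedAlgebra {c ℓ} (R : CommutativeRing c ℓ) {G : Set}
                        (Rl : Tm R G → Tm R G → Set (c ⊔ ℓ)) where
  private module S = CommutativeRing R
  open ScalarLemmas R
  open S using (Carrier) renaming (_≈_ to _≈ˢ_)

  infix 4 _≋_
  _≋_ : Tm R G → Tm R G → Set (c ⊔ ℓ)
  _≋_ = Cong R Rl

  -- chosen so that the ring subtraction _-_ is definitionally Defs._⊖_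
  neg : Tm R G → Tm R G
  neg t = sc (S.- S.1#) ⊗ t

  presentedRing : Ring c (c ⊔ ℓ)
  presentedRing = record
    { Carrier = Tm R G ; _≈_ = _≋_ ; _+_ = _⊕_ ; _*_ = _⊗_ ; -_ = neg
    ; 0# = sc S.0# ; 1# = sc S.1#
    ; isRing = record
      { +-isAbelianGroup = record
        { isGroup = record
          { isMonoid = record
            { isSemigroup = record
              { isMagma = record
                { isEquivalence = record { refl = refl′ ; sym = sym′ ; trans = trans′ }
                ; ∙-cong = c⊕-cong }
              ; assoc = c⊕-assoc }
            ; identity = (λ x → trans′ (c⊕-comm _ x) (c⊕-zero x)) , c⊕-zero }
          ; inverse = (λ x → trans′ (c⊕-comm _ x) (c⊕-inv x)) , c⊕-inv
          ; ⁻¹-cong = c⊗-cong refl′ }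
        ; comm = c⊕-comm }
      ; *-cong = c⊗-cong
      ; *-assoc = c⊗-assoc
      ; *-identity = c⊗-oneˡ , c⊗-oneʳ
      ; distrib = cdistribˡ , cdistribʳ } }

  open Ring presentedRing public
    using (_-_; setoid; +-assoc; +-identityˡ; +-identityʳ; -‿inverseˡ; zeroʳ)
  open RingProperties presentedRing public
    using (x[y-z]≈xy-xz; [y-z]x≈yx-zx)
  open AbelianGroupProperties (Ring.+-abelianGroup presentedRing) public
    using (x∙y⁻¹≈ε⇒x≈y; x≈y⇒x∙y⁻¹≈ε; ⁻¹-∙-comm)
  open CommutativeSemigroupProperties (Ring.+-commutativeSemigroup presentedRing)
    using () renaming (interchange to +-interchange)
  open SetoidReasoning setoid public

  [_,_] : Tm R G → Tm R G → Tm R G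
  [ x , y ] = comm R x y

  sc-assoc : ∀ a b t → sc a ⊗ (sc b ⊗ t) ≋ sc (a S.* b) ⊗ t
  sc-assoc a b t = begin
    sc a ⊗ (sc b ⊗ t)  ≈⟨ c⊗-assoc (sc a) (sc b) t ⟨
    sc a ⊗ sc b ⊗ t    ≈⟨ c⊗-cong (csc-* a b) refl′ ⟨
    sc (a S.* b) ⊗ t   ∎

  sc-cancel : ∀ {a b} t → a S.* b ≈ˢ S.1# → sc a ⊗ (sc b ⊗ t) ≋ t
  sc-cancel {a} {b} t ab≈1 = begin
    sc a ⊗ (sc b ⊗ t)  ≈⟨ sc-assoc a b t ⟩
    sc (a S.* b) ⊗ t   ≈⟨ c⊗-cong (csc-cong ab≈1) refl′ ⟩
    sc S.1# ⊗ t        ≈⟨ c⊗-oneˡ t ⟩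
    t                  ∎

  sc-slide : ∀ a s t → s ⊗ (sc a ⊗ t) ≋ sc a ⊗ (s ⊗ t)
  sc-slide a s t = begin
    s ⊗ (sc a ⊗ t)  ≈⟨ c⊗-assoc s (sc a) t ⟨
    s ⊗ sc a ⊗ t    ≈⟨ c⊗-cong (csc-central a s) refl′ ⟨
    sc a ⊗ s ⊗ t    ≈⟨ c⊗-assoc (sc a) s t ⟩
    sc a ⊗ (s ⊗ t)  ∎

  [x-y]+[y-z]≈x-z : ∀ s t u → (s - t) ⊕ (t - u) ≋ s - u
  [x-y]+[y-z]≈x-z s t u = begin
    (s - t) ⊕ (t - u)        ≈⟨ +-assoc s (neg t) (t - u) ⟩
    s ⊕ (neg t ⊕ (t - u))    ≈⟨ c⊕-cong refl′ (+-assoc (neg t) t (neg u)) ⟨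
    s ⊕ (neg t ⊕ t ⊕ neg u)  ≈⟨ c⊕-cong refl′ (c⊕-cong (-‿inverseˡ t) refl′) ⟩
    s ⊕ (sc S.0# ⊕ neg u)    ≈⟨ c⊕-cong refl′ (+-identityˡ (neg u)) ⟩
    s - u                    ∎

  infix 4 _⇄⟨_⟩_
  _⇄⟨_⟩_ : Tm R G → Carrier → Tm R G → Set (c ⊔ ℓ)
  x ⇄⟨ a ⟩ y = x ⊗ y ≋ sc a ⊗ (y ⊗ x)

  ⇄-cong : ∀ {x y a b} → a ≈ˢ b → x ⇄⟨ a ⟩ y → x ⇄⟨ b ⟩ y
  ⇄-cong a≈b xy = trans′ xy (c⊗-cong (csc-cong a≈b) refl′)

  ⇄-refl : ∀ {x} → x ⇄⟨ S.1# ⟩ x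
  ⇄-refl = sym′ (c⊗-oneˡ _)

  ⇄-one⇒commute : ∀ {x y} → x ⇄⟨ S.1# ⟩ y → x ⊗ y ≋ y ⊗ x
  ⇄-one⇒commute xy = trans′ xy (c⊗-oneˡ _)

  comm≋0⇒⇄-one : ∀ {x y} → [ x , y ] ≋ sc S.0# → x ⇄⟨ S.1# ⟩ y
  comm≋0⇒⇄-one {x} {y} [x,y]≋0 = trans′ (x∙y⁻¹≈ε⇒x≈y (x ⊗ y) (y ⊗ x) [x,y]≋0) (sym′ (c⊗-oneˡ (y ⊗ x)))

  ⇄-one⇒comm≋0 : ∀ {x y} → x ⇄⟨ S.1# ⟩ y → [ x , y ] ≋ sc S.0#
  ⇄-one⇒comm≋0 xy = x≈y⇒x∙y⁻¹≈ε (⇄-one⇒commute xy)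

  ⇄-sym : ∀ {x y a b} → a S.* b ≈ˢ S.1# → x ⇄⟨ a ⟩ y → y ⇄⟨ b ⟩ x
  ⇄-sym {x} {y} {a} {b} ab≈1 xy = begin
    y ⊗ x                    ≈⟨ sc-cancel (y ⊗ x) (S.trans (S.*-comm b a) ab≈1) ⟨
    sc b ⊗ (sc a ⊗ (y ⊗ x))  ≈⟨ c⊗-cong refl′ xy ⟨
    sc b ⊗ (x ⊗ y)           ∎

  ⇄-sym-one : ∀ {x y} → x ⇄⟨ S.1# ⟩ y → y ⇄⟨ S.1# ⟩ x
  ⇄-sym-one = ⇄-sym (S.*-identityˡ S.1#)

  ⇄-⊗ˡ : ∀ {x y z a b} → x ⇄⟨ a ⟩ z → y ⇄⟨ b ⟩ z → x ⊗ y ⇄⟨ a S.* b ⟩ z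
  ⇄-⊗ˡ {x} {y} {z} {a} {b} xz yz = begin
    x ⊗ y ⊗ z                      ≈⟨ c⊗-assoc x y z ⟩
    x ⊗ (y ⊗ z)                    ≈⟨ c⊗-cong refl′ yz ⟩
    x ⊗ (sc b ⊗ (z ⊗ y))           ≈⟨ sc-slide b x (z ⊗ y) ⟩
    sc b ⊗ (x ⊗ (z ⊗ y))           ≈⟨ c⊗-cong refl′ (c⊗-assoc x z y) ⟨
    sc b ⊗ (x ⊗ z ⊗ y)             ≈⟨ c⊗-cong refl′ (c⊗-cong xz refl′) ⟩
    sc b ⊗ (sc a ⊗ (z ⊗ x) ⊗ y)    ≈⟨ c⊗-cong refl′ (c⊗-assoc (sc a) (z ⊗ x) y) ⟩
    sc b ⊗ (sc a ⊗ (z ⊗ x ⊗ y))    ≈⟨ sc-assoc b a (z ⊗ x ⊗ y) ⟩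
    sc (b S.* a) ⊗ (z ⊗ x ⊗ y)     ≈⟨ c⊗-cong (csc-cong (S.*-comm b a)) (c⊗-assoc z x y) ⟩
    sc (a S.* b) ⊗ (z ⊗ (x ⊗ y))   ∎

  ⇄-⊗ʳ : ∀ {x y z a b} → x ⇄⟨ a ⟩ y → x ⇄⟨ b ⟩ z → x ⇄⟨ a S.* b ⟩ y ⊗ z
  ⇄-⊗ʳ {x} {y} {z} {a} {b} xy xz = begin
    x ⊗ (y ⊗ z)                    ≈⟨ c⊗-assoc x y z ⟨
    x ⊗ y ⊗ z                      ≈⟨ c⊗-cong xy refl′ ⟩
    sc a ⊗ (y ⊗ x) ⊗ z             ≈⟨ c⊗-assoc (sc a) (y ⊗ x) z ⟩
    sc a ⊗ (y ⊗ x ⊗ z)             ≈⟨ c⊗-cong refl′ (c⊗-assoc y x z) ⟩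
    sc a ⊗ (y ⊗ (x ⊗ z))           ≈⟨ c⊗-cong refl′ (c⊗-cong refl′ xz) ⟩
    sc a ⊗ (y ⊗ (sc b ⊗ (z ⊗ x)))  ≈⟨ c⊗-cong refl′ (sc-slide b y (z ⊗ x)) ⟩
    sc a ⊗ (sc b ⊗ (y ⊗ (z ⊗ x)))  ≈⟨ sc-assoc a b (y ⊗ (z ⊗ x)) ⟩
    sc (a S.* b) ⊗ (y ⊗ (z ⊗ x))   ≈⟨ c⊗-cong refl′ (c⊗-assoc y z x) ⟨
    sc (a S.* b) ⊗ (y ⊗ z ⊗ x)     ∎

  ⇄-⊕ˡ : ∀ {x y z a} → x ⇄⟨ a ⟩ z → y ⇄⟨ a ⟩ z → x ⊕ y ⇄⟨ a ⟩ z
  ⇄-⊕ˡ {x} {y} {z} {a} xz yz = begin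
    (x ⊕ y) ⊗ z                          ≈⟨ cdistribʳ z x y ⟩
    x ⊗ z ⊕ y ⊗ z                        ≈⟨ c⊕-cong xz yz ⟩
    sc a ⊗ (z ⊗ x) ⊕ sc a ⊗ (z ⊗ y)      ≈⟨ cdistribˡ (sc a) (z ⊗ x) (z ⊗ y) ⟨
    sc a ⊗ (z ⊗ x ⊕ z ⊗ y)               ≈⟨ c⊗-cong refl′ (cdistribˡ z x y) ⟨
    sc a ⊗ (z ⊗ (x ⊕ y))                 ∎

  ⇄-⊕ʳ : ∀ {x y z a} → x ⇄⟨ a ⟩ y → x ⇄⟨ a ⟩ z → x ⇄⟨ a ⟩ y ⊕ z
  ⇄-⊕ʳ {x} {y} {z} {a} xy xz = begin
    x ⊗ (y ⊕ z)                          ≈⟨ cdistribˡ x y z ⟩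
    x ⊗ y ⊕ x ⊗ z                        ≈⟨ c⊕-cong xy xz ⟩
    sc a ⊗ (y ⊗ x) ⊕ sc a ⊗ (z ⊗ x)      ≈⟨ cdistribˡ (sc a) (y ⊗ x) (z ⊗ x) ⟨
    sc a ⊗ (y ⊗ x ⊕ z ⊗ x)               ≈⟨ c⊗-cong refl′ (cdistribʳ x y z) ⟨
    sc a ⊗ ((y ⊕ z) ⊗ x)                 ∎

  ⇄-inverseʳ : ∀ {x x′ y a} → x ⊗ x′ ≋ sc S.1# → x′ ⊗ x ≋ sc S.1# →
               x ⇄⟨ a ⟩ y → y ⇄⟨ a ⟩ x′
  ⇄-inverseʳ {x} {x′} {y} {a} xx′≋1 x′x≋1 xy = begin
    y ⊗ x′                               ≈⟨ c⊗-cong cancelˡ refl′ ⟨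
    x′ ⊗ (x ⊗ y) ⊗ x′                    ≈⟨ c⊗-cong (c⊗-cong refl′ xy) refl′ ⟩
    x′ ⊗ (sc a ⊗ (y ⊗ x)) ⊗ x′           ≈⟨ c⊗-cong (sc-slide a x′ (y ⊗ x)) refl′ ⟩
    sc a ⊗ (x′ ⊗ (y ⊗ x)) ⊗ x′           ≈⟨ c⊗-assoc (sc a) (x′ ⊗ (y ⊗ x)) x′ ⟩
    sc a ⊗ (x′ ⊗ (y ⊗ x) ⊗ x′)           ≈⟨ c⊗-cong refl′ (c⊗-cong (c⊗-assoc x′ y x) refl′) ⟨
    sc a ⊗ (x′ ⊗ y ⊗ x ⊗ x′)             ≈⟨ c⊗-cong refl′ cancelʳ ⟩
    sc a ⊗ (x′ ⊗ y)                      ∎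
    where
    cancelˡ : x′ ⊗ (x ⊗ y) ≋ y
    cancelˡ = trans′ (sym′ (c⊗-assoc x′ x y)) (trans′ (c⊗-cong x′x≋1 refl′) (c⊗-oneˡ y))
    cancelʳ : x′ ⊗ y ⊗ x ⊗ x′ ≋ x′ ⊗ y
    cancelʳ = trans′ (c⊗-assoc (x′ ⊗ y) x x′) (trans′ (c⊗-cong refl′ xx′≋1) (c⊗-oneʳ (x′ ⊗ y)))

  ⇄-inverseˡ : ∀ {x x′ y a b} → x ⊗ x′ ≋ sc S.1# → x′ ⊗ x ≋ sc S.1# → a S.* b ≈ˢ S.1# →
               x ⇄⟨ a ⟩ y → x′ ⇄⟨ b ⟩ y
  ⇄-inverseˡ xx′≋1 x′x≋1 ab≈1 xy = ⇄-sym ab≈1 (⇄-inverseʳ xx′≋1 x′x≋1 xy)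

  ⊗-inverse : ∀ {x x′ y y′} → x ⊗ x′ ≋ sc S.1# → y ⊗ y′ ≋ sc S.1# → y ⇄⟨ S.1# ⟩ x′ →
              (x ⊗ y) ⊗ (x′ ⊗ y′) ≋ sc S.1#
  ⊗-inverse {x} {x′} {y} {y′} xx′≋1 yy′≋1 yx′ = begin
    (x ⊗ y) ⊗ (x′ ⊗ y′)    ≈⟨ c⊗-assoc x y (x′ ⊗ y′) ⟩
    x ⊗ (y ⊗ (x′ ⊗ y′))    ≈⟨ c⊗-cong refl′ (c⊗-assoc y x′ y′) ⟨
    x ⊗ (y ⊗ x′ ⊗ y′)      ≈⟨ c⊗-cong refl′ (c⊗-cong (⇄-one⇒commute yx′) refl′) ⟩
    x ⊗ (x′ ⊗ y ⊗ y′)      ≈⟨ c⊗-cong refl′ (c⊗-assoc x′ y y′) ⟩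
    x ⊗ (x′ ⊗ (y ⊗ y′))    ≈⟨ c⊗-assoc x x′ (y ⊗ y′) ⟨
    x ⊗ x′ ⊗ (y ⊗ y′)      ≈⟨ c⊗-cong xx′≋1 yy′≋1 ⟩
    sc S.1# ⊗ sc S.1#      ≈⟨ c⊗-oneˡ (sc S.1#) ⟩
    sc S.1#                ∎

  qcomm≋scaled-diff : ∀ {q qi} x y → q S.* qi ≈ˢ S.1# →
                      qcomm R q qi x y ≋ sc q ⊗ (x ⊗ y - sc (qi S.* qi) ⊗ (y ⊗ x))
  qcomm≋scaled-diff {q} {qi} x y qqi≈1 = sym′ (begin
    sc q ⊗ (x ⊗ y - sc (qi S.* qi) ⊗ (y ⊗ x))
      ≈⟨ x[y-z]≈xy-xz (sc q) (x ⊗ y) (sc (qi S.* qi) ⊗ (y ⊗ x)) ⟩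
    sc q ⊗ (x ⊗ y) - sc q ⊗ (sc (qi S.* qi) ⊗ (y ⊗ x))
      ≈⟨ c⊕-cong (sym′ (c⊗-assoc (sc q) x y)) (c⊗-cong refl′ rescale) ⟩
    qcomm R q qi x y ∎)
    where
    rescale : sc q ⊗ (sc (qi S.* qi) ⊗ (y ⊗ x)) ≋ sc qi ⊗ y ⊗ x
    rescale = begin
      sc q ⊗ (sc (qi S.* qi) ⊗ (y ⊗ x))  ≈⟨ sc-assoc q (qi S.* qi) (y ⊗ x) ⟩
      sc (q S.* (qi S.* qi)) ⊗ (y ⊗ x)   ≈⟨ c⊗-cong (csc-cong (inverse-times-square qqi≈1)) refl′ ⟩
      sc qi ⊗ (y ⊗ x)                    ≈⟨ c⊗-assoc (sc qi) y x ⟨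
      sc qi ⊗ y ⊗ x                      ∎

  qcomm≋0⇒⇄ : ∀ {q qi x y} → q S.* qi ≈ˢ S.1# →
              qcomm R q qi x y ≋ sc S.0# → x ⇄⟨ qi S.* qi ⟩ y
  qcomm≋0⇒⇄ {q} {qi} {x} {y} qqi≈1 qcomm≋0 = x∙y⁻¹≈ε⇒x≈y _ _ (begin
    x ⊗ y - sc (qi S.* qi) ⊗ (y ⊗ x)
      ≈⟨ sc-cancel _ (S.trans (S.*-comm qi q) qqi≈1) ⟨
    sc qi ⊗ (sc q ⊗ (x ⊗ y - sc (qi S.* qi) ⊗ (y ⊗ x)))
      ≈⟨ c⊗-cong refl′ (qcomm≋scaled-diff x y qqi≈1) ⟨
    sc qi ⊗ qcomm R q qi x y  ≈⟨ c⊗-cong refl′ qcomm≋0 ⟩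
    sc qi ⊗ sc S.0#           ≈⟨ zeroʳ (sc qi) ⟩
    sc S.0#                   ∎)

  ⇄⇒qcomm≋0 : ∀ {q qi x y} → q S.* qi ≈ˢ S.1# →
              x ⇄⟨ qi S.* qi ⟩ y → qcomm R q qi x y ≋ sc S.0#
  ⇄⇒qcomm≋0 {q} {qi} {x} {y} qqi≈1 xy = begin
    qcomm R q qi x y                                   ≈⟨ qcomm≋scaled-diff x y qqi≈1 ⟩
    sc q ⊗ (x ⊗ y - sc (qi S.* qi) ⊗ (y ⊗ x))          ≈⟨ c⊗-cong refl′ (x≈y⇒x∙y⁻¹≈ε xy) ⟩
    sc q ⊗ sc S.0#                                     ≈⟨ zeroʳ (sc q) ⟩
    sc S.0#                                            ∎

  [x+y,z]≈[x,z]+[y,z] : ∀ x y z → [ x ⊕ y , z ] ≋ [ x , z ] ⊕ [ y , z ]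
  [x+y,z]≈[x,z]+[y,z] x y z = begin
    (x ⊕ y) ⊗ z - z ⊗ (x ⊕ y)                ≈⟨ c⊕-cong (cdistribʳ z x y) (c⊗-cong refl′ (cdistribˡ z x y)) ⟩
    (x ⊗ z ⊕ y ⊗ z) - (z ⊗ x ⊕ z ⊗ y)        ≈⟨ c⊕-cong refl′ (⁻¹-∙-comm (z ⊗ x) (z ⊗ y)) ⟨
    (x ⊗ z ⊕ y ⊗ z) ⊕ (neg (z ⊗ x) ⊕ neg (z ⊗ y))  ≈⟨ +-interchange (x ⊗ z) (y ⊗ z) _ _ ⟩
    [ x , z ] ⊕ [ y , z ]                    ∎

  [x,y+z]≈[x,y]+[x,z] : ∀ x y z → [ x , y ⊕ z ] ≋ [ x , y ] ⊕ [ x , z ]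
  [x,y+z]≈[x,y]+[x,z] x y z = begin
    x ⊗ (y ⊕ z) - (y ⊕ z) ⊗ x                ≈⟨ c⊕-cong (cdistribˡ x y z) (c⊗-cong refl′ (cdistribʳ x y z)) ⟩
    (x ⊗ y ⊕ x ⊗ z) - (y ⊗ x ⊕ z ⊗ x)        ≈⟨ c⊕-cong refl′ (⁻¹-∙-comm (y ⊗ x) (z ⊗ x)) ⟨
    (x ⊗ y ⊕ x ⊗ z) ⊕ (neg (y ⊗ x) ⊕ neg (z ⊗ x))  ≈⟨ +-interchange (x ⊗ y) (x ⊗ z) _ _ ⟩
    [ x , y ] ⊕ [ x , z ]                    ∎

  [x,yz]≈[x,y]z : ∀ {x z} y → x ⇄⟨ S.1# ⟩ z → [ x , y ⊗ z ] ≋ [ x , y ] ⊗ z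
  [x,yz]≈[x,y]z {x} {z} y xz = begin
    x ⊗ (y ⊗ z) - y ⊗ z ⊗ x      ≈⟨ c⊕-cong (sym′ (c⊗-assoc x y z)) (c⊗-cong refl′ yzx≋yxz) ⟩
    x ⊗ y ⊗ z - y ⊗ x ⊗ z        ≈⟨ [y-z]x≈yx-zx z (x ⊗ y) (y ⊗ x) ⟨
    [ x , y ] ⊗ z                ∎
    where
    yzx≋yxz : y ⊗ z ⊗ x ≋ y ⊗ x ⊗ z
    yzx≋yxz = begin
      y ⊗ z ⊗ x    ≈⟨ c⊗-assoc y z x ⟩
      y ⊗ (z ⊗ x)  ≈⟨ c⊗-cong refl′ (⇄-one⇒commute xz) ⟨
      y ⊗ (x ⊗ z)  ≈⟨ c⊗-assoc y x z ⟨
      y ⊗ x ⊗ z    ∎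

  [zx,y]≈z[x,y] : ∀ {y z} x → z ⇄⟨ S.1# ⟩ y → [ z ⊗ x , y ] ≋ z ⊗ [ x , y ]
  [zx,y]≈z[x,y] {y} {z} x zy = begin
    z ⊗ x ⊗ y - y ⊗ (z ⊗ x)      ≈⟨ c⊕-cong (c⊗-assoc z x y) (c⊗-cong refl′ yzx≋zyx) ⟩
    z ⊗ (x ⊗ y) - z ⊗ (y ⊗ x)    ≈⟨ x[y-z]≈xy-xz z (x ⊗ y) (y ⊗ x) ⟨
    z ⊗ [ x , y ]                ∎
    where
    yzx≋zyx : y ⊗ (z ⊗ x) ≋ z ⊗ (y ⊗ x)
    yzx≋zyx = begin
      y ⊗ (z ⊗ x)  ≈⟨ c⊗-assoc y z x ⟨
      y ⊗ z ⊗ x    ≈⟨ c⊗-cong (⇄-one⇒commute zy) refl′ ⟨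
      z ⊗ y ⊗ x    ≈⟨ c⊗-assoc z y x ⟩
      z ⊗ (y ⊗ x)  ∎

module Extension {c ℓ} (R : CommutativeRing c ℓ) {G H : Set}
                 {RlG : Tm R G → Tm R G → Set (c ⊔ ℓ)}
                 {RlH : Tm R H → Tm R H → Set (c ⊔ ℓ)}
                 (f : G → Tm R H) where

  extend : Tm R G → Tm R H
  extend (gen x) = f x
  extend (sc a)  = sc a
  extend (s ⊕ t) = extend s ⊕ extend t
  extend (s ⊗ t) = extend s ⊗ extend t

  extend-resp : (∀ {s t} → RlG s t → Cong R RlH (extend s) (extend t)) →
                ∀ {s t} → Cong R RlG s t → Cong R RlH (extend s) (extend t)
  extend-resp resp-rel = go
    where
    go : ∀ {s t} → Cong R RlG s t → Cong R RlH (extend s) (extend t)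
    go (rel r)               = resp-rel r
    go refl′                 = refl′
    go (sym′ p)              = sym′ (go p)
    go (trans′ p p′)         = trans′ (go p) (go p′)
    go (c⊕-cong p p′)        = c⊕-cong (go p) (go p′)
    go (c⊗-cong p p′)        = c⊗-cong (go p) (go p′)
    go (c⊕-assoc s t u)      = c⊕-assoc (extend s) (extend t) (extend u)
    go (c⊕-comm s t)         = c⊕-comm (extend s) (extend t)
    go (c⊕-zero s)           = c⊕-zero (extend s)
    go (c⊕-inv s)            = c⊕-inv (extend s)
    go (c⊗-assoc s t u)      = c⊗-assoc (extend s) (extend t) (extend u)
    go (c⊗-oneˡ s)           = c⊗-oneˡ (extend s)
    go (c⊗-oneʳ s)           = c⊗-oneʳ (extend s)
    go (cdistribˡ s t u)     = cdistribˡ (extend s) (extend t) (extend u)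
    go (cdistribʳ s t u)     = cdistribʳ (extend s) (extend t) (extend u)
    go (csc-cong a≈b)        = csc-cong a≈b
    go (csc-+ a b)           = csc-+ a b
    go (csc-* a b)           = csc-* a b
    go (csc-central a s)     = csc-central a (extend s)

  extend-unique : (ψ : Tm R G → Tm R H) →
                  (∀ x → Cong R RlH (f x) (ψ (gen x))) →
                  (∀ a → Cong R RlH (ψ (sc a)) (sc a)) →
                  (∀ s t → Cong R RlH (ψ (s ⊕ t)) (ψ s ⊕ ψ t)) →
                  (∀ s t → Cong R RlH (ψ (s ⊗ t)) (ψ s ⊗ ψ t)) →
                  ∀ t → Cong R RlH (extend t) (ψ t)
  extend-unique ψ gens scalars sums products = go
    where
    go : ∀ t → Cong R RlH (extend t) (ψ t)
    go (gen x) = gens x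
    go (sc a)  = sym′ (scalars a)
    go (s ⊕ t) = trans′ (c⊕-cong (go s) (go t)) (sym′ (sums s t))
    go (s ⊗ t) = trans′ (c⊗-cong (go s) (go t)) (sym′ (products s t))

module Comultiplication {c ℓ} (R : CommutativeRing c ℓ) (q qi d : CommutativeRing.Carrier R)
                 (q*qi≈1 : CommutativeRing._≈_ R (CommutativeRing._*_ R q qi) (CommutativeRing.1# R))
                 where
  private module S = CommutativeRing R
  open ScalarLemmas R
  open Rels R q qi d
  open PresentedAlgebra R RelW

  qi*q≈1 : qi S.* q S.≈ S.1#
  qi*q≈1 = S.trans (S.*-comm qi q) q*qi≈1

  qi² : S.Carrier
  qi² = qi S.* qi

  Δ-gen : GenU → Tm R GenW
  Δ-gen E    = w E₁ ⊕ w K₁inv ⊗ w E₂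
  Δ-gen F    = w F₁ ⊗ w K₂ ⊕ w F₂
  Δ-gen K    = w K₁ ⊗ w K₂
  Δ-gen Kinv = w K₁inv ⊗ w K₂inv

  open Extension R {RlG = RelU} {RlH = RelW} Δ-gen public
    using (extend-resp; extend-unique) renaming (extend to Δ)

  K₁⇄K₂ : w K₁ ⇄⟨ S.1# ⟩ w K₂
  K₁⇄K₂ = comm≋0⇒⇄-one (rel K₁K₂)
  K₁⇄E₂ : w K₁ ⇄⟨ S.1# ⟩ w E₂
  K₁⇄E₂ = comm≋0⇒⇄-one (rel K₁E₂)
  K₁⇄F₂ : w K₁ ⇄⟨ S.1# ⟩ w F₂
  K₁⇄F₂ = comm≋0⇒⇄-one (rel K₁F₂)
  K₂⇄E₁ : w K₂ ⇄⟨ S.1# ⟩ w E₁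
  K₂⇄E₁ = comm≋0⇒⇄-one (rel K₂E₁)
  K₂⇄F₁ : w K₂ ⇄⟨ S.1# ⟩ w F₁
  K₂⇄F₁ = comm≋0⇒⇄-one (rel K₂F₁)
  F₁⇄E₂ : w F₁ ⇄⟨ S.1# ⟩ w E₂
  F₁⇄E₂ = comm≋0⇒⇄-one (rel F₁E₂)
  I⇄ : ∀ x → w I ⇄⟨ S.1# ⟩ w x
  I⇄ x = comm≋0⇒⇄-one (rel (I-central x))

  E₁⇄K₁ : w E₁ ⇄⟨ qi² ⟩ w K₁
  E₁⇄K₁ = qcomm≋0⇒⇄ q*qi≈1 (rel E₁K₁)
  K₁⇄F₁ : w K₁ ⇄⟨ qi² ⟩ w F₁
  K₁⇄F₁ = qcomm≋0⇒⇄ q*qi≈1 (rel K₁F₁)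
  E₂⇄K₂ : w E₂ ⇄⟨ qi² ⟩ w K₂
  E₂⇄K₂ = qcomm≋0⇒⇄ q*qi≈1 (rel E₂K₂)
  K₂⇄F₂ : w K₂ ⇄⟨ qi² ⟩ w F₂
  K₂⇄F₂ = qcomm≋0⇒⇄ q*qi≈1 (rel K₂F₂)

  K₁⁻¹-inverse : ∀ {x a b} → a S.* b S.≈ S.1# → w K₁ ⇄⟨ a ⟩ x → w K₁inv ⇄⟨ b ⟩ x
  K₁⁻¹-inverse = ⇄-inverseˡ (rel K₁K₁inv) (rel K₁invK₁)

  K₁⁻¹⇄K₁K₂ : w K₁inv ⇄⟨ S.1# ⟩ w K₁ ⊗ w K₂
  K₁⁻¹⇄K₁K₂ = ⇄-cong (S.*-identityˡ S.1#)
    (⇄-⊗ʳ (K₁⁻¹-inverse (S.*-identityˡ S.1#) ⇄-refl) (K₁⁻¹-inverse (S.*-identityˡ S.1#) K₁⇄K₂))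

  ΔE⇄ΔK : Δ-gen E ⇄⟨ qi² ⟩ Δ-gen K
  ΔE⇄ΔK = ⇄-⊕ˡ (⇄-cong (S.*-identityʳ qi²) (⇄-⊗ʳ E₁⇄K₁ (⇄-sym-one K₂⇄E₁)))
               (⇄-cong (S.*-identityˡ qi²) (⇄-⊗ˡ K₁⁻¹⇄K₁K₂ E₂⇄K₁K₂))
    where
    E₂⇄K₁K₂ : w E₂ ⇄⟨ qi² ⟩ w K₁ ⊗ w K₂
    E₂⇄K₁K₂ = ⇄-cong (S.*-identityˡ qi²) (⇄-⊗ʳ (⇄-sym-one K₁⇄E₂) E₂⇄K₂)

  ΔK⇄ΔF : Δ-gen K ⇄⟨ qi² ⟩ Δ-gen F
  ΔK⇄ΔF = ⇄-⊕ʳ (⇄-cong (S.trans (S.*-identityʳ _) (S.*-identityʳ qi²)) (⇄-⊗ˡ K₁⇄F₁K₂ K₂⇄F₁K₂))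
               (⇄-cong (S.*-identityˡ qi²) (⇄-⊗ˡ K₁⇄F₂ K₂⇄F₂))
    where
    K₁⇄F₁K₂ : w K₁ ⇄⟨ qi² S.* S.1# ⟩ w F₁ ⊗ w K₂
    K₁⇄F₁K₂ = ⇄-⊗ʳ K₁⇄F₁ K₁⇄K₂
    K₂⇄F₁K₂ : w K₂ ⇄⟨ S.1# ⟩ w F₁ ⊗ w K₂
    K₂⇄F₁K₂ = ⇄-cong (S.*-identityˡ S.1#) (⇄-⊗ʳ K₂⇄F₁ ⇄-refl)

  K₁⁻¹E₂⇄F₁K₂ : w K₁inv ⊗ w E₂ ⇄⟨ S.1# ⟩ w F₁ ⊗ w K₂
  K₁⁻¹E₂⇄F₁K₂ = ⇄-cong (S.trans (S.*-cong (S.*-identityʳ _) (S.*-identityˡ qi²))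
                                (inverse-squares q*qi≈1))
                       (⇄-⊗ˡ K₁⁻¹⇄F₁K₂ E₂⇄F₁K₂)
    where
    K₁⁻¹⇄F₁K₂ : w K₁inv ⇄⟨ (q S.* q) S.* S.1# ⟩ w F₁ ⊗ w K₂
    K₁⁻¹⇄F₁K₂ = ⇄-⊗ʳ (K₁⁻¹-inverse (inverse-squares qi*q≈1) K₁⇄F₁)
                     (K₁⁻¹-inverse (S.*-identityˡ S.1#) K₁⇄K₂)
    E₂⇄F₁K₂ : w E₂ ⇄⟨ S.1# S.* qi² ⟩ w F₁ ⊗ w K₂
    E₂⇄F₁K₂ = ⇄-⊗ʳ (⇄-sym-one F₁⇄E₂) E₂⇄K₂

  [ΔE,ΔF]≈diagonal : [ Δ-gen E , Δ-gen F ] ≋ [ w E₁ , w F₁ ] ⊗ w K₂ ⊕ w K₁inv ⊗ [ w E₂ , w F₂ ]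
  [ΔE,ΔF]≈diagonal = begin
    [ w E₁ ⊕ w K₁inv ⊗ w E₂ , Δ-gen F ]
      ≈⟨ [x+y,z]≈[x,z]+[y,z] (w E₁) (w K₁inv ⊗ w E₂) (Δ-gen F) ⟩
    [ w E₁ , w F₁ ⊗ w K₂ ⊕ w F₂ ] ⊕ [ w K₁inv ⊗ w E₂ , w F₁ ⊗ w K₂ ⊕ w F₂ ]
      ≈⟨ c⊕-cong ([x,y+z]≈[x,y]+[x,z] (w E₁) (w F₁ ⊗ w K₂) (w F₂))
                 ([x,y+z]≈[x,y]+[x,z] (w K₁inv ⊗ w E₂) (w F₁ ⊗ w K₂) (w F₂)) ⟩
    ([ w E₁ , w F₁ ⊗ w K₂ ] ⊕ [ w E₁ , w F₂ ]) ⊕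
    ([ w K₁inv ⊗ w E₂ , w F₁ ⊗ w K₂ ] ⊕ [ w K₁inv ⊗ w E₂ , w F₂ ])
      ≈⟨ c⊕-cong (c⊕-cong ([x,yz]≈[x,y]z (w F₁) (⇄-sym-one K₂⇄E₁)) (rel E₁F₂))
                 (c⊕-cong (⇄-one⇒comm≋0 K₁⁻¹E₂⇄F₁K₂)
                          ([zx,y]≈z[x,y] (w E₂) (K₁⁻¹-inverse (S.*-identityˡ S.1#) K₁⇄F₂))) ⟩
    ([ w E₁ , w F₁ ] ⊗ w K₂ ⊕ sc S.0#) ⊕ (sc S.0# ⊕ w K₁inv ⊗ [ w E₂ , w F₂ ])
      ≈⟨ c⊕-cong (+-identityʳ _) (+-identityˡ _) ⟩
    [ w E₁ , w F₁ ] ⊗ w K₂ ⊕ w K₁inv ⊗ [ w E₂ , w F₂ ] ∎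

  Cartan-telescope : (w K₁ - w I ⊗ w K₁inv) ⊗ w K₂ ⊕ w K₁inv ⊗ (w I ⊗ w K₂ - w K₂inv)
                     ≋ w K₁ ⊗ w K₂ - w K₁inv ⊗ w K₂inv
  Cartan-telescope = begin
    (w K₁ - w I ⊗ w K₁inv) ⊗ w K₂ ⊕ w K₁inv ⊗ (w I ⊗ w K₂ - w K₂inv)
      ≈⟨ c⊕-cong ([y-z]x≈yx-zx (w K₂) (w K₁) (w I ⊗ w K₁inv))
                 (x[y-z]≈xy-xz (w K₁inv) (w I ⊗ w K₂) (w K₂inv)) ⟩
    (w K₁ ⊗ w K₂ - w I ⊗ w K₁inv ⊗ w K₂) ⊕ (w K₁inv ⊗ (w I ⊗ w K₂) - w K₁inv ⊗ w K₂inv)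
      ≈⟨ c⊕-cong (c⊕-cong refl′ (c⊗-cong refl′ IK₁⁻¹K₂≋K₁⁻¹IK₂)) refl′ ⟩
    (w K₁ ⊗ w K₂ - w K₁inv ⊗ (w I ⊗ w K₂)) ⊕ (w K₁inv ⊗ (w I ⊗ w K₂) - w K₁inv ⊗ w K₂inv)
      ≈⟨ [x-y]+[y-z]≈x-z _ _ _ ⟩
    w K₁ ⊗ w K₂ - w K₁inv ⊗ w K₂inv ∎
    where
    IK₁⁻¹K₂≋K₁⁻¹IK₂ : w I ⊗ w K₁inv ⊗ w K₂ ≋ w K₁inv ⊗ (w I ⊗ w K₂)
    IK₁⁻¹K₂≋K₁⁻¹IK₂ = trans′ (c⊗-cong (⇄-one⇒commute (I⇄ K₁inv)) refl′) (c⊗-assoc _ _ _)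

  [ΔE,ΔF]≈d[ΔK-ΔKinv] : [ Δ-gen E , Δ-gen F ] ≋ sc d ⊗ (Δ-gen K - Δ-gen Kinv)
  [ΔE,ΔF]≈d[ΔK-ΔKinv] = begin
    [ Δ-gen E , Δ-gen F ]
      ≈⟨ [ΔE,ΔF]≈diagonal ⟩
    [ w E₁ , w F₁ ] ⊗ w K₂ ⊕ w K₁inv ⊗ [ w E₂ , w F₂ ]
      ≈⟨ c⊕-cong (c⊗-cong (rel E₁F₁) refl′) (c⊗-cong refl′ (rel E₂F₂)) ⟩
    sc d ⊗ (w K₁ - w I ⊗ w K₁inv) ⊗ w K₂ ⊕ w K₁inv ⊗ (sc d ⊗ (w I ⊗ w K₂ - w K₂inv))
      ≈⟨ c⊕-cong (c⊗-assoc _ _ _) (sc-slide d _ _) ⟩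
    sc d ⊗ ((w K₁ - w I ⊗ w K₁inv) ⊗ w K₂) ⊕ sc d ⊗ (w K₁inv ⊗ (w I ⊗ w K₂ - w K₂inv))
      ≈⟨ cdistribˡ (sc d) _ _ ⟨
    sc d ⊗ ((w K₁ - w I ⊗ w K₁inv) ⊗ w K₂ ⊕ w K₁inv ⊗ (w I ⊗ w K₂ - w K₂inv))
      ≈⟨ c⊗-cong refl′ Cartan-telescope ⟩
    sc d ⊗ (Δ-gen K - Δ-gen Kinv) ∎

  Δ-resp-rel : ∀ {s t} → RelU s t → Δ s ≈W Δ t
  Δ-resp-rel KKinv = ⊗-inverse (rel K₁K₁inv) (rel K₂K₂inv)
                               (⇄-inverseʳ (rel K₁K₁inv) (rel K₁invK₁) K₁⇄K₂)
  Δ-resp-rel KinvK = ⊗-inverse (rel K₁invK₁) (rel K₂invK₂)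
                               (⇄-inverseˡ (rel K₂K₂inv) (rel K₂invK₂) (S.*-identityˡ S.1#)
                                           (⇄-sym-one K₁⇄K₂))
  Δ-resp-rel EK    = ⇄⇒qcomm≋0 q*qi≈1 ΔE⇄ΔK
  Δ-resp-rel KF    = ⇄⇒qcomm≋0 q*qi≈1 ΔK⇄ΔF
  Δ-resp-rel EF    = [ΔE,ΔF]≈d[ΔK-ΔKinv]

  Δ-isAlgHom : IsAlgHom Δ
  Δ-isAlgHom = record
    { resp = extend-resp Δ-resp-rel
    ; pres⊕ = λ _ _ → refl′
    ; pres⊗ = λ _ _ → refl′
    ; presSc = λ _ → refl′
    }

  Δ-sendsGens : SendsGens Δ
  Δ-sendsGens = refl′ , refl′ , refl′ , refl′

  Δ-unique : (ψ : Tm R GenU → Tm R GenW) → IsAlgHom ψ → SendsGens ψ → ∀ t → Δ t ≈W ψ t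
  Δ-unique ψ ψ-hom (ψE , ψF , ψK , ψKinv) = extend-unique ψ ψ-gen presSc pres⊕ pres⊗
    where
    open IsAlgHom ψ-hom
    ψ-gen : ∀ x → Δ-gen x ≈W ψ (gen x)
    ψ-gen E    = sym′ ψE
    ψ-gen F    = sym′ ψF
    ψ-gen K    = sym′ ψK
    ψ-gen Kinv = sym′ ψKinv

theorem3p1 : ∀ {c ℓ} (R : CommutativeRing c ℓ) → IsFieldCR R →
    (q qi d : CommutativeRing.Carrier R) →
    CommutativeRing._≈_ R (CommutativeRing._*_ R q qi) (CommutativeRing.1# R) →
    NotRootOfUnity R q →
    CommutativeRing._≈_ R
      (CommutativeRing._*_ R d (CommutativeRing._-_ R q qi)) (CommutativeRing.1# R) →
    Σ (Tm R GenU → Tm R GenW) (λ φ →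
      Rels.IsAlgHom R q qi d φ × Rels.SendsGens R q qi d φ ×
      ((ψ : Tm R GenU → Tm R GenW) → Rels.IsAlgHom R q qi d ψ →
        Rels.SendsGens R q qi d ψ → ∀ t → Rels._≈W_ R q qi d (φ t) (ψ t)))
theorem3p1 R _ q qi d q*qi≈1 _ _ = Δ , Δ-isAlgHom , Δ-sendsGens , Δ-unique
  where open Comultiplication R q qi d q*qi≈1
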